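{- Let $T_1$ and $T_2$ be two nontrivial trees with orders $m$ and $n$ respectively. Then $hn_{cc}(T_1\Box T_2)=m+n-1$.
   Context: All graphs are finite, simple and undirected. Cycle convexity on a graph $G$: for $S\subseteq V(G)$, the cycle interval $\langle S\rangle$ is $S$ together with every vertex $w\in V(G)$ that lies on a cycle of the induced subgraph $G[S\cup\{w\}]$ passing through $w$. $S$ is (cycle) convex if $\langle S\rangle=S$. The cycle convex hull $\langle S\rangle_C$ is the smallest convex set containing $S$. $S$ is a hull set if $\langle S\rangle_C=V(G)$, and $hn_{cc}(G)$ is the minimum cardinality of a hull set of $G$. The Cartesian product $G\Box H$ has vertex set $V(G)\times V(H)$, with $(g_1,h_1)\sim(g_2,h_2)$ iff ($g_1\sim g_2$ and $h_1=h_2$) or ($g_1=g_2$ and $h_1\sim h_2$). A tree is nontrivial if it has at least two vertices. -}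

module Defs where

open import Data.Nat using (ℕ; suc; _+_; _*_)
open import Data.Fin using (Fin; zero; suc; remQuot; fromℕ)
open import Data.Fin.Subset using (Subset; _∈_; _⊆_)
open import Data.Product using (Σ; ∃; _×_; _,_; proj₁; proj₂)
open import Data.Sum using (_⊎_)
open import Data.Empty using (⊥)
open import Relation.Nullary using (¬_)
open import Relation.Binary using (Decidable)
open import Relation.Binary.PropositionalEquality using (_≡_)
open import Relation.Binary.Construct.Closure.ReflexiveTransitive using (Star)
open import Function.Definitions using (Injective)

Graph : ℕ → Set₁
Graph n = Fin n → Fin n → Set

record IsSimple {n : ℕ} (G : Graph n) : Set where
  field
    sym     : ∀ {u v} → G u v → G v u
    irrefl  : ∀ {u} → ¬ G u u
    decAdj  : Decidable G

record Cycle {n : ℕ} (G : Graph n) : Set where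
  field
    len     : ℕ
    vtx     : Fin (3 + len) → Fin n
    inj     : Injective _≡_ _≡_ vtx
    step    : ∀ (i : Fin (2 + len)) → G (vtx (Data.Fin.inject₁ i)) (vtx (suc i))
    close   : G (vtx (fromℕ (2 + len))) (vtx zero)
open Cycle public

CycleIn : ∀ {n} (G : Graph n) → (Fin n → Set) → Cycle G → Set
CycleIn G P c = ∀ i → P (vtx c i)

Through : ∀ {n} {G : Graph n} → Cycle G → Fin n → Set
Through c w = ∃ λ i → vtx c i ≡ w

OnCycleWith : ∀ {n} (G : Graph n) → Subset n → Fin n → Set
OnCycleWith G S w =
  Σ (Cycle G) λ c → CycleIn G (λ v → v ∈ S ⊎ v ≡ w) c × Through c w

Interval : ∀ {n} (G : Graph n) → Subset n → Fin n → Set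
Interval G S w = w ∈ S ⊎ OnCycleWith G S w

Convex : ∀ {n} (G : Graph n) → Subset n → Set
Convex G S = ∀ w → Interval G S w → w ∈ S

InHull : ∀ {n : ℕ} (G : Graph n) → Subset n → Fin n → Set
InHull {n} G S w = ∀ (C : Subset n) → Convex G C → S ⊆ C → w ∈ C

IsHullSet : ∀ {n} (G : Graph n) → Subset n → Set
IsHullSet G S = ∀ w → InHull G S w

Connected : ∀ {n} (G : Graph n) → Set
Connected G = ∀ u v → Star G u v

Acyclic : ∀ {n} (G : Graph n) → Set
Acyclic G = Cycle G → ⊥

IsTree : ∀ {n} (G : Graph n) → Set
IsTree G = IsSimple G × Connected G × Acyclic G

_□_ : ∀ {m n} → Graph m → Graph n → Graph (m * n)
_□_ {m} {n} G H x y =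
  let (g₁ , h₁) = remQuot {m} n x
      (g₂ , h₂) = remQuot {m} n y
  in (G g₁ g₂ × h₁ ≡ h₂) ⊎ (g₁ ≡ g₂ × H h₁ h₂)

{-# OPTIONS --safe #-}
-- The first row and the first column of T₁ □ T₂ form a hull set of size m + n − 1: when three
-- corners of a square (g,h), (g′,h), (g′,h′), (g,h′) lie in a convex set, the 4-cycle forces the
-- fourth, and stepping g and h towards the axes along walks in the two trees sweeps out every vertex.
--
-- Conversely, read each x ∈ S as an edge between row x and column x of a bipartite graph on the
-- m + n rows and columns. If ∣S∣ ≤ m + n − 2 this graph is disconnected, so there are colourings
-- f of the rows and g of the columns, equal along these edges, with f (row x) ≠ g (col x) for some
-- x. The agreement set {x | f (row x) ≡ g (col x)} then contains S but not every vertex, and it is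
-- convex: a vertex w outside it lying on a cycle through agreeing vertices has two distinct
-- neighbours joined by an agreeing walk; f ∘ row is constant along that walk, so both neighbours
-- share w's column or both share w's row, and projecting the walk yields a cycle in T₁ or in T₂.

module Submission where

open import Defs
open import Data.Bool using (Bool; true; false)
import Data.Bool.Properties as Bool
open import Data.Empty using (⊥-elim)
open import Data.Fin using (Fin; zero; suc; inject₁; fromℕ; combine; quotient; remainder; punchIn; punchOut; _↑ˡ_; _↑ʳ_; splitAt)
open import Data.Fin.Induction using (>-weakInduction)
open import Data.Fin.Properties
  using (_≟_; 0≢1+n; fromℕ≢inject₁; inject₁-injective; remQuot-combine; combine-remQuot; combine-injective;
         punchOut-cong; punchOut-punchIn; punchInᵢ≢i; splitAt⁻¹-↑ˡ; splitAt⁻¹-↑ʳ)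
open import Data.Fin.Subset using (Subset; ∣_∣; _∈_; ⊤; ⁅_⁆; inside; outside)
open import Data.Fin.Subset.Properties using (∈⊤; ∣⊤∣≡n; ∣⁅x⁆∣≡1)
open import Data.Nat using (ℕ; zero; suc; _+_; _*_; _∸_; _≤_; s≤s)
open import Data.Nat.Properties using (+-comm; m≤n⇒m≤1+n; ≮⇒≥)
open import Data.Product using (Σ; _×_; _,_; proj₁; proj₂)
open import Data.Sum using (_⊎_; inj₁; inj₂; [_,_]′)
import Data.Sum as Sum
open import Data.Vec using (Vec; []; _∷_; _++_; lookup; tabulate; here; there)
open import Data.Vec.Properties using (lookup∘tabulate; lookup⇒[]=; []=⇒lookup)
open import Data.Vec.Relation.Unary.All as All using (All; []; _∷_)
open import Data.Vec.Relation.Unary.Any as Any using ()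
open import Data.Vec.Relation.Unary.AllPairs using ([]; _∷_)
open import Data.Vec.Relation.Unary.Unique.Propositional using (Unique)
open import Data.Vec.Relation.Unary.Unique.Propositional.Properties using (lookup-injective)
open import Data.Vec.Membership.Propositional renaming (_∈_ to _∈ᵥ_)
open import Function using (_∘_)
open import Function.Definitions using (Injective)
open import Level using (0ℓ)
open import Relation.Binary using (Rel; DecidableEquality)
open import Relation.Binary.Construct.Closure.ReflexiveTransitive using (Star; ε; _◅_)
import Relation.Binary.Construct.Closure.ReflexiveTransitive as Star
open import Relation.Binary.PropositionalEquality
  using (_≡_; _≢_; refl; sym; trans; cong; cong₂; subst; subst₂; module ≡-Reasoning)
open import Relation.Nullary using (¬_; yes; no; does; contradiction)
open import Relation.Nullary.Decidable using (dec-true; toSum)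
open import Relation.Unary using (Pred; Decidable)

private
  variable
    n : ℕ

-- Cycles and bypasses

Induced : Graph n → Pred (Fin n) 0ℓ → Graph n
Induced G P x y = G x y × P x × P y

induced-walk-target : ∀ {G : Graph n} {P x y} → P x → Star (Induced G P) x y → P y
induced-walk-target Px ε                    = Px
induced-walk-target _  ((_ , _ , Py) ◅ walk) = induced-walk-target Py walk

walk-along : ∀ {K} {G : Graph n} {P} (u : Fin (suc K) → Fin n) → (∀ j → P (u j)) →
             (∀ j → G (u (inject₁ j)) (u (suc j))) → Star (Induced G P) (u zero) (u (fromℕ K))
walk-along {K = zero}  u Pu adj = ε
walk-along {K = suc K} u Pu adj =
  (adj zero , Pu zero , Pu (suc zero)) ◅ walk-along (u ∘ suc) (Pu ∘ suc) (adj ∘ suc)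

-- What remains of a cycle through w, all of whose other vertices satisfy P, once w is removed.
record Bypass (G : Graph n) (P : Pred (Fin n) 0ℓ) (w : Fin n) : Set where
  field
    {s p} : Fin n
    w∼s   : G w s
    p∼w   : G p w
    s≢p   : s ≢ p
    P-s   : P s
    walk  : Star (Induced G P) s p

Bypass-map : ∀ {G : Graph n} {P Q w} → (∀ {x} → P x → Q x) → Bypass G P w → Bypass G Q w
Bypass-map P⇒Q bp = record
  { w∼s = w∼s ; p∼w = p∼w ; s≢p = s≢p ; P-s = P⇒Q P-s
  ; walk = Star.map (λ (e , Px , Py) → e , P⇒Q Px , P⇒Q Py) walk }
  where open Bypass bp

-- Cycle G with the length as an index, so that rotating a cycle does not change its type.
record IsCycle (G : Graph n) {K} (v : Fin (suc K) → Fin n) : Set where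
  field
    injective : Injective _≡_ _≡_ v
    edge      : ∀ i → G (v (inject₁ i)) (v (suc i))
    closing   : G (v (fromℕ K)) (v zero)
open IsCycle

isCycle : ∀ {G : Graph n} (c : Cycle G) → IsCycle G (vtx c)
isCycle c = record { injective = inj c ; edge = step c ; closing = close c }

prev : ∀ {K} → Fin (suc K) → Fin (suc K)
prev zero    = fromℕ _
prev (suc i) = inject₁ i

prev-injective : ∀ {K} → Injective _≡_ _≡_ (prev {K})
prev-injective {x = zero}  {zero}  _  = refl
prev-injective {x = zero}  {suc j} eq = contradiction eq fromℕ≢inject₁
prev-injective {x = suc i} {zero}  eq = contradiction (sym eq) fromℕ≢inject₁
prev-injective {x = suc i} {suc j} eq = cong suc (inject₁-injective eq)

rotate : ∀ {G : Graph n} {K} {v : Fin (2 + K) → Fin n} → IsCycle G v → IsCycle G (v ∘ prev)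
rotate {K = K} c = record
  { injective = prev-injective ∘ injective c
  ; edge      = λ { zero → closing c ; (suc i) → edge c (inject₁ i) }
  ; closing   = edge c (fromℕ K)
  }

module _ {G : Graph n} {S : Subset n} {w : Fin n} where

  private
    InS∪w : ∀ {K} → (Fin (suc K) → Fin n) → Set
    InS∪w v = ∀ j → v j ∈ S ⊎ v j ≡ w

  bypass-at-last : ∀ {L} {v : Fin (3 + L) → Fin n} → IsCycle G v → InS∪w v →
                   v (fromℕ (2 + L)) ≡ w → Bypass G (_∈ S) w
  bypass-at-last {L} {v} c through vℓ≡w = record
    { w∼s  = subst (λ x → G x (v zero)) vℓ≡w (closing c)
    ; p∼w  = subst (G (v (inject₁ (fromℕ (suc L))))) vℓ≡w (edge c (fromℕ (suc L)))
    ; s≢p  = 0≢1+n ∘ injective c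
    ; P-s  = in-S zero 0≢1+n
    ; walk = walk-along (v ∘ inject₁) (λ j → in-S (inject₁ j) (fromℕ≢inject₁ ∘ sym)) (edge c ∘ inject₁)
    }
    where
    in-S : ∀ j → j ≢ fromℕ (2 + L) → v j ∈ S
    in-S j j≢ℓ with through j
    ... | inj₁ vj∈S = vj∈S
    ... | inj₂ vj≡w = contradiction (injective c (trans vj≡w (sym vℓ≡w))) j≢ℓ

  -- Rotating the cycle moves w to the last position.
  bypass-at : ∀ {L} {v : Fin (3 + L) → Fin n} → IsCycle G v → InS∪w v →
              ∀ i → v i ≡ w → Bypass G (_∈ S) w
  bypass-at {L} c through i = >-weakInduction Q bypass-at-last shift i c through
    where
    Q : Fin (3 + L) → Set
    Q i = ∀ {v} → IsCycle G v → InS∪w v → v i ≡ w → Bypass G (_∈ S) w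
    shift : ∀ i → Q (suc i) → Q (inject₁ i)
    shift i q c through = q (rotate c) (through ∘ prev)

  cycle⇒bypass : OnCycleWith G S w → Bypass G (_∈ S) w
  cycle⇒bypass (c , through , i , vi≡w) = bypass-at (isCycle c) through i vi≡w

subset : ∀ {P : Pred (Fin n) 0ℓ} → Decidable P → Subset n
subset P? = tabulate (does ∘ P?)

module _ {P : Pred (Fin n) 0ℓ} (P? : Decidable P) where

  ∈-subset⁺ : ∀ {x} → P x → x ∈ subset P?
  ∈-subset⁺ {x} Px = lookup⇒[]= x _ (trans (lookup∘tabulate (does ∘ P?) x) (dec-true (P? x) Px))

  ∈-subset⁻ : ∀ {x} → x ∈ subset P? → P x
  ∈-subset⁻ {x} x∈ with P? x | trans (sym (lookup∘tabulate (does ∘ P?) x)) ([]=⇒lookup x∈)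
  ... | yes Px | _  = Px
  ... | no _   | ()

  ¬bypass⇒convex : ∀ {G : Graph n} → (∀ {w} → ¬ P w → ¬ Bypass G P w) → Convex G (subset P?)
  ¬bypass⇒convex no-bypass w (inj₁ w∈) = w∈
  ¬bypass⇒convex no-bypass w (inj₂ on-cycle) with P? w
  ... | yes Pw  = ∈-subset⁺ Pw
  ... | no ¬Pw = ⊥-elim (no-bypass ¬Pw (Bypass-map ∈-subset⁻ (cycle⇒bypass on-cycle)))

module _ {A : Set} (R : Rel A 0ℓ) where

  data Path : A → A → ∀ {k} → Vec A (suc k) → Set where
    [_] : ∀ a → Path a a (a ∷ [])
    _∷_ : ∀ {a b c k} {xs : Vec A (suc k)} → R a b → Path b c xs → Path a c (a ∷ xs)

  record SimplePath (a b : A) : Set where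
    field
      {k}      : ℕ
      vertices : Vec A (suc k)
      path     : Path a b vertices
      unique   : Unique vertices

module _ {A : Set} {R : Rel A 0ℓ} where

  open SimplePath

  path-edge : ∀ {a b k} {xs : Vec A (suc k)} → Path R a b xs → ∀ i → R (lookup xs (inject₁ i)) (lookup xs (suc i))
  path-edge (r ∷ [ _ ])   zero    = r
  path-edge (r ∷ (_ ∷ _)) zero    = r
  path-edge (_ ∷ rs)      (suc i) = path-edge rs i

  path-end : ∀ {a b k} {xs : Vec A (suc k)} → Path R a b xs → lookup xs (fromℕ k) ≡ b
  path-end [ _ ]    = refl
  path-end (_ ∷ rs) = path-end rs

  suffix : ∀ {a b c k} {xs : Vec A (suc k)} → Path R a b xs → Unique xs → c ∈ᵥ xs → SimplePath R c b
  suffix [ _ ]      u       (Any.here refl) = record { path = [ _ ] ; unique = u }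
  suffix (r ∷ rs)   u       (Any.here refl) = record { path = r ∷ rs ; unique = u }
  suffix (_ ∷ rs)   (_ ∷ u) (Any.there c∈)  = suffix rs u c∈

  module _ (_≟ᴬ_ : DecidableEquality A) where

    shortcut : ∀ {a b} → Star R a b → SimplePath R a b
    shortcut {a} ε = record { path = [ a ] ; unique = [] ∷ [] }
    shortcut {a} (r ◅ rs) with shortcut rs
    ... | sp with All.decide (λ x → Sum.swap (toSum (a ≟ᴬ x))) (vertices sp)
    ... | inj₂ a∈ = suffix (path sp) (unique sp) a∈
    ... | inj₁ a∉ = record { path = r ∷ path sp ; unique = a∉ ∷ unique sp }

module _ {n : ℕ} {G : Graph n} {P : Pred (Fin n) 0ℓ} where

  open SimplePath

  path-All : ∀ {a b k} {xs : Vec (Fin n) (suc k)} → P a → Path (Induced G P) a b xs → All P xs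
  path-All Pa [ _ ]                 = Pa ∷ []
  path-All Pa ((_ , _ , Pb) ∷ rest) = Pa ∷ path-All Pb rest

  closing-cycle : ∀ {w a b k} {xs : Vec (Fin n) (2 + k)} → ¬ P w → G w a → G b w → P a →
                  Path (Induced G P) a b xs → Unique xs → Cycle G
  closing-cycle {w} {k = k} {xs} ¬Pw w∼a b∼w Pa path@(_ ∷ _) unique = record
    { len   = k
    ; vtx   = lookup (w ∷ xs)
    ; inj   = λ {i} {j} → lookup-injective (All.map w≢ (path-All Pa path) ∷ unique) i j
    ; step  = λ { zero → w∼a ; (suc i) → proj₁ (path-edge path i) }
    ; close = subst (λ x → G x w) (sym (path-end path)) b∼w
    }
    where
    w≢ : ∀ {x} → P x → w ≢ x
    w≢ Px refl = ¬Pw Px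

  acyclic⇒¬bypass : Acyclic G → ∀ {w} → ¬ P w → ¬ Bypass G P w
  acyclic⇒¬bypass acyclic ¬Pw bp with shortcut _≟_ (Bypass.walk bp)
  ... | record { path = [ _ ] }                   = Bypass.s≢p bp refl
  ... | record { path = path@(_ ∷ _) ; unique = u } =
    acyclic (closing-cycle ¬Pw (Bypass.w∼s bp) (Bypass.p∼w bp) (Bypass.P-s bp) path u)

-- Agreement sets in products of forests

module Coordinates (m n : ℕ) where

  row : Fin (m * n) → Fin m
  row = quotient n

  col : Fin (m * n) → Fin n
  col = remainder {m} n

  row-combine : ∀ g h → row (combine g h) ≡ g
  row-combine g h = cong proj₁ (remQuot-combine g h)

  col-combine : ∀ g h → col (combine {m} g h) ≡ h
  col-combine g h = cong proj₂ (remQuot-combine g h)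

  coordinates-injective : ∀ {x y} → row x ≡ row y → col x ≡ col y → x ≡ y
  coordinates-injective {x} {y} r c = begin
    x                         ≡⟨ combine-remQuot {m} n x ⟨
    combine (row x) (col x)   ≡⟨ cong₂ combine r c ⟩
    combine (row y) (col y)   ≡⟨ combine-remQuot {m} n y ⟩
    y                         ∎
    where open ≡-Reasoning

module Agreement {m n : ℕ} {T₁ : Graph m} {T₂ : Graph n} {A : Set} (f : Fin m → A) (g : Fin n → A) where

  open Coordinates m n

  Agrees : Fin (m * n) → Set
  Agrees x = f (row x) ≡ g (col x)

  private
    AgreeingWalk : Fin (m * n) → Fin (m * n) → Set
    AgreeingWalk = Star (Induced (T₁ □ T₂) Agrees)

  rows-of-walk : ∀ {x y b} → AgreeingWalk x y → f (row x) ≡ b → Star (Induced T₁ (λ a → f a ≡ b)) (row x) (row y)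
  rows-of-walk ε _ = ε
  rows-of-walk ((inj₁ (e , cx≡cy) , agx , agy) ◅ walk) fx≡b =
    (e , fx≡b , fy≡b) ◅ rows-of-walk walk fy≡b
    where fy≡b = trans (trans agy (cong g (sym cx≡cy))) (trans (sym agx) fx≡b)
  rows-of-walk ((inj₂ (rx≡ry , _) , _) ◅ walk) fx≡b =
    subst (λ r → Star _ r _) (sym rx≡ry) (rows-of-walk walk (trans (cong f (sym rx≡ry)) fx≡b))

  cols-of-walk : ∀ {x y b} → AgreeingWalk x y → g (col x) ≡ b → Star (Induced T₂ (λ a → g a ≡ b)) (col x) (col y)
  cols-of-walk ε _ = ε
  cols-of-walk ((inj₁ (_ , cx≡cy) , _) ◅ walk) gx≡b =
    subst (λ c → Star _ c _) (sym cx≡cy) (cols-of-walk walk (trans (cong g (sym cx≡cy)) gx≡b))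
  cols-of-walk ((inj₂ (rx≡ry , e) , agx , agy) ◅ walk) gx≡b =
    (e , gx≡b , gy≡b) ◅ cols-of-walk walk gy≡b
    where gy≡b = trans (trans (sym agy) (cong f (sym rx≡ry))) (trans agx gx≡b)

  row-colour-of-walk : ∀ {x y} → AgreeingWalk x y → f (row x) ≡ f (row y)
  row-colour-of-walk walk = sym (induced-walk-target refl (rows-of-walk walk refl))

  bypass-projects : ∀ {w} → ¬ Agrees w → Bypass (T₁ □ T₂) Agrees w →
    Bypass T₁ (λ a → f a ≡ g (col w)) (row w) ⊎ Bypass T₂ (λ b → g b ≡ f (row w)) (col w)
  bypass-projects {w} ¬agw bp with Bypass.w∼s bp | Bypass.p∼w bp
  ... | inj₁ (w∼s , cw≡cs) | inj₁ (p∼w , cp≡cw) = inj₁ record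
    { w∼s  = w∼s
    ; p∼w  = p∼w
    ; s≢p  = λ rs≡rp → Bypass.s≢p bp (coordinates-injective rs≡rp (trans (sym cw≡cs) (sym cp≡cw)))
    ; P-s  = fs≡gw
    ; walk = rows-of-walk (Bypass.walk bp) fs≡gw
    }
    where fs≡gw = trans (Bypass.P-s bp) (cong g (sym cw≡cs))
  ... | inj₂ (rw≡rs , w∼s) | inj₂ (rp≡rw , p∼w) = inj₂ record
    { w∼s  = w∼s
    ; p∼w  = p∼w
    ; s≢p  = λ cs≡cp → Bypass.s≢p bp (coordinates-injective (trans (sym rw≡rs) (sym rp≡rw)) cs≡cp)
    ; P-s  = gs≡fw
    ; walk = cols-of-walk (Bypass.walk bp) gs≡fw
    }
    where gs≡fw = trans (sym (Bypass.P-s bp)) (cong f (sym rw≡rs))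
  ... | inj₁ (_ , cw≡cs) | inj₂ (rp≡rw , _) = ⊥-elim (¬agw (begin
    f (row w)              ≡⟨ cong f (sym rp≡rw) ⟩
    f (row (Bypass.p bp))  ≡⟨ row-colour-of-walk (Bypass.walk bp) ⟨
    f (row (Bypass.s bp))  ≡⟨ Bypass.P-s bp ⟩
    g (col (Bypass.s bp))  ≡⟨ cong g cw≡cs ⟨
    g (col w)              ∎))
    where open ≡-Reasoning
  ... | inj₂ (rw≡rs , _) | inj₁ (_ , cp≡cw) = ⊥-elim (¬agw (begin
    f (row w)              ≡⟨ cong f rw≡rs ⟩
    f (row (Bypass.s bp))  ≡⟨ row-colour-of-walk (Bypass.walk bp) ⟩
    f (row (Bypass.p bp))  ≡⟨ induced-walk-target (Bypass.P-s bp) (Bypass.walk bp) ⟩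
    g (col (Bypass.p bp))  ≡⟨ cong g cp≡cw ⟩
    g (col w)              ∎))
    where open ≡-Reasoning

module _ {m n} {T₁ : Graph m} {T₂ : Graph n} (acyclic₁ : Acyclic T₁) (acyclic₂ : Acyclic T₂) where

  open Coordinates m n

  agreement-convex : ∀ {A : Set} (_≟_ : DecidableEquality A) (f : Fin m → A) (g : Fin n → A) →
                     Convex (T₁ □ T₂) (subset (λ x → f (row x) ≟ g (col x)))
  agreement-convex _≟_ f g = ¬bypass⇒convex (λ x → f (row x) ≟ g (col x)) λ ¬agw bp →
    [ acyclic⇒¬bypass acyclic₁ ¬agw , acyclic⇒¬bypass acyclic₂ (¬agw ∘ sym) ]′ (bypass-projects ¬agw bp)
    where open Agreement {T₁ = T₁} {T₂} f g

-- The lower bound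

record Disconnection {k N : ℕ} (S : Subset k) (u v : Fin k → Fin N) : Set where
  field
    side     : Fin N → Bool
    respects : ∀ {x} → x ∈ S → side (u x) ≡ side (v x)
    {a b}    : Fin N
    splits   : side a ≢ side b

module Contraction {N : ℕ} {a b : Fin (suc N)} (b≢a : b ≢ a) where

  contract : Fin (suc N) → Fin N
  contract x with b ≟ x
  ... | yes _   = punchOut b≢a
  ... | no b≢x = punchOut b≢x

  contract-identifies : contract b ≡ contract a
  contract-identifies with b ≟ b | b ≟ a
  ... | yes _  | no _    = punchOut-cong b refl
  ... | yes _  | yes b≡a = contradiction b≡a b≢a
  ... | no b≢b | _       = contradiction refl b≢b

  contract-punchIn : ∀ y → contract (punchIn b y) ≡ y
  contract-punchIn y with b ≟ punchIn b y
  ... | yes b≡y′ = contradiction (sym b≡y′) (punchInᵢ≢i b y)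
  ... | no _     = trans (punchOut-cong b refl) (punchOut-punchIn b)

-- Contracting one edge at a time: each contraction removes an edge and a vertex.
disconnection : ∀ {k N} (S : Subset k) (u v : Fin k → Fin N) → 2 + ∣ S ∣ ≤ N → Disconnection S u v
disconnection [] u v (s≤s (s≤s _)) = record
  { side     = λ { zero → true ; (suc _) → false }
  ; respects = λ ()
  ; a        = zero
  ; b        = suc zero
  ; splits   = λ ()
  }
disconnection (outside ∷ S) u v small =
  record { side = side d ; respects = λ { (there x∈S) → respects d x∈S } ; splits = splits d }
  where
  open Disconnection
  d = disconnection S (u ∘ suc) (v ∘ suc) small
disconnection (inside ∷ S) u v (s≤s small) with v zero ≟ u zero
... | yes v₀≡u₀ = record
  { side     = side d
  ; respects = λ { here → cong (side d) (sym v₀≡u₀) ; (there x∈S) → respects d x∈S }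
  ; splits   = splits d
  }
  where
  open Disconnection
  d = disconnection S (u ∘ suc) (v ∘ suc) (m≤n⇒m≤1+n small)
... | no v₀≢u₀ = record
  { side     = side d ∘ contract
  ; respects = λ { here → cong (side d) (sym contract-identifies) ; (there x∈S) → respects d x∈S }
  ; a        = punchIn (v zero) (a d)
  ; b        = punchIn (v zero) (b d)
  ; splits   = λ eq → splits d (subst₂ _≡_ (lift (a d)) (lift (b d)) eq)
  }
  where
  open Disconnection
  open Contraction v₀≢u₀
  d = disconnection S (contract ∘ u ∘ suc) (contract ∘ v ∘ suc) small
  lift : ∀ y → side d (contract (punchIn (v zero) y)) ≡ side d y
  lift y = cong (side d) (contract-punchIn y)

left≡right⇒constant : ∀ {m n} {A : Set} (c : Fin (m + n) → A) → (∀ g h → c (g ↑ˡ n) ≡ c (m ↑ʳ h)) →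
                      Fin m → Fin n → ∀ z z′ → c z ≡ c z′
left≡right⇒constant {m} {n} c left≡right g₀ h₀ z z′ = trans (to-h₀ z) (sym (to-h₀ z′))
  where
  to-h₀ : ∀ z → c z ≡ c (m ↑ʳ h₀)
  to-h₀ z with splitAt m z in eq
  ... | inj₁ g = subst (λ z → c z ≡ _) (splitAt⁻¹-↑ˡ eq) (left≡right g h₀)
  ... | inj₂ h = subst (λ z → c z ≡ _) (splitAt⁻¹-↑ʳ eq) (trans (sym (left≡right g₀ h)) (left≡right g₀ h₀))

module _ {m n} {T₁ : Graph (suc m)} {T₂ : Graph (suc n)} (acyclic₁ : Acyclic T₁) (acyclic₂ : Acyclic T₂) where

  open Coordinates (suc m) (suc n)

  small⇒¬hullSet : ∀ {S} → 2 + ∣ S ∣ ≤ suc m + suc n → ¬ IsHullSet (T₁ □ T₂) S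
  small⇒¬hullSet {S} small hull = splits (left≡right⇒constant side left≡right zero zero a b)
    where
    open Disconnection (disconnection S (λ x → row x ↑ˡ suc n) (λ x → suc m ↑ʳ col x) small)
    colourˡ : Fin (suc m) → Bool
    colourˡ g = side (g ↑ˡ suc n)
    colourʳ : Fin (suc n) → Bool
    colourʳ h = side (suc m ↑ʳ h)
    agrees? = λ x → colourˡ (row x) Bool.≟ colourʳ (col x)
    left≡right : ∀ g h → colourˡ g ≡ colourʳ h
    left≡right g h = subst₂ (λ g h → colourˡ g ≡ colourʳ h) (row-combine g h) (col-combine g h)
      (∈-subset⁻ agrees? (hull (combine g h) _ (agreement-convex acyclic₁ acyclic₂ Bool._≟_ colourˡ colourʳ)
                                                (∈-subset⁺ agrees? ∘ respects)))

  hullSet-size : ∀ {S} → IsHullSet (T₁ □ T₂) S → suc m + suc n ∸ 1 ≤ ∣ S ∣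
  hullSet-size hull = ≮⇒≥ (λ small → small⇒¬hullSet (s≤s small) hull)

-- The upper bound

∈-++⁺ˡ : ∀ {k l} {p : Subset k} {q : Subset l} {x} → x ∈ p → x ↑ˡ l ∈ p ++ q
∈-++⁺ˡ here       = here
∈-++⁺ˡ (there x∈) = there (∈-++⁺ˡ x∈)

∈-++⁺ʳ : ∀ {k l} (p : Subset k) {q : Subset l} {x} → x ∈ q → k ↑ʳ x ∈ p ++ q
∈-++⁺ʳ []      x∈ = x∈
∈-++⁺ʳ (_ ∷ p) x∈ = there (∈-++⁺ʳ p x∈)

∣p++q∣≡∣p∣+∣q∣ : ∀ {k l} (p : Subset k) (q : Subset l) → ∣ p ++ q ∣ ≡ ∣ p ∣ + ∣ q ∣
∣p++q∣≡∣p∣+∣q∣ []            q = refl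
∣p++q∣≡∣p∣+∣q∣ (inside ∷ p)  q = cong suc (∣p++q∣≡∣p∣+∣q∣ p q)
∣p++q∣≡∣p∣+∣q∣ (outside ∷ p) q = ∣p++q∣≡∣p∣+∣q∣ p q

firstColumn : ∀ m n → Subset (m * suc n)
firstColumn zero    n = []
firstColumn (suc m) n = ⁅ zero ⁆ ++ firstColumn m n

axes : ∀ m n → Subset (suc m * suc n)
axes m n = ⊤ ++ firstColumn m n

∣firstColumn∣ : ∀ m n → ∣ firstColumn m n ∣ ≡ m
∣firstColumn∣ zero    n = refl
∣firstColumn∣ (suc m) n = begin
  ∣ ⁅ zero {n} ⁆ ++ firstColumn m n ∣     ≡⟨ ∣p++q∣≡∣p∣+∣q∣ ⁅ zero {n} ⁆ (firstColumn m n) ⟩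
  ∣ ⁅ zero {n} ⁆ ∣ + ∣ firstColumn m n ∣ ≡⟨ cong₂ _+_ (∣⁅x⁆∣≡1 (zero {n})) (∣firstColumn∣ m n) ⟩
  suc m                                  ∎
  where open ≡-Reasoning

∣axes∣ : ∀ m n → ∣ axes m n ∣ ≡ suc m + suc n ∸ 1
∣axes∣ m n = begin
  ∣ ⊤ {suc n} ++ firstColumn m n ∣    ≡⟨ ∣p++q∣≡∣p∣+∣q∣ (⊤ {suc n}) (firstColumn m n) ⟩
  ∣ ⊤ {suc n} ∣ + ∣ firstColumn m n ∣ ≡⟨ cong₂ _+_ (∣⊤∣≡n (suc n)) (∣firstColumn∣ m n) ⟩
  suc n + m                             ≡⟨ +-comm (suc n) m ⟩
  m + suc n                             ∎
  where open ≡-Reasoning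

firstRow∈axes : ∀ {m n} (h : Fin (suc n)) → combine {suc m} zero h ∈ axes m n
firstRow∈axes {m} {n} h = ∈-++⁺ˡ {q = firstColumn m n} ∈⊤

firstColumn∈axes : ∀ {m n} (g : Fin (suc m)) → combine {suc m} {suc n} g zero ∈ axes m n
firstColumn∈axes {m} {n} zero = ∈-++⁺ˡ {q = firstColumn m n} ∈⊤
firstColumn∈axes (suc g) = ∈-++⁺ʳ ⊤ (column g)
  where
  column : ∀ {m n} (g : Fin m) → combine {m} {suc n} g zero ∈ firstColumn m n
  column zero    = here
  column (suc g) = ∈-++⁺ʳ ⁅ zero ⁆ (column g)

module ProductEdges {m n} (G : Graph m) (H : Graph n) where

  open Coordinates m n

  □-edgeˡ : ∀ {g g′ h} → G g g′ → (G □ H) (combine g h) (combine g′ h)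
  □-edgeˡ {g} {g′} {h} e =
    inj₁ (subst₂ G (sym (row-combine g h)) (sym (row-combine g′ h)) e , trans (col-combine g h) (sym (col-combine g′ h)))

  □-edgeʳ : ∀ {g h h′} → H h h′ → (G □ H) (combine g h) (combine g h′)
  □-edgeʳ {g} {h} {h′} e =
    inj₂ (trans (row-combine g h) (sym (row-combine g h′)) , subst₂ H (sym (col-combine g h)) (sym (col-combine g h′)) e)

module _ {m n} {G : Graph m} {H : Graph n} (simple₁ : IsSimple G) (simple₂ : IsSimple H) where

  open ProductEdges G H

  square : ∀ {g g′ h h′} → G g g′ → H h h′ → Cycle (G □ H)
  square {g} {g′} {h} {h′} e e′ = record
    { len   = 1
    ; vtx   = lookup corners
    ; inj   = λ {i} {j} → lookup-injective distinct i j
    ; step  = λ { zero → □-edgeˡ e ; (suc zero) → □-edgeʳ e′ ; (suc (suc zero)) → □-edgeˡ (IsSimple.sym simple₁ e) }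
    ; close = □-edgeʳ (IsSimple.sym simple₂ e′)
    }
    where
    corners : Vec (Fin (m * n)) 4
    corners = combine g h ∷ combine g′ h ∷ combine g′ h′ ∷ combine g h′ ∷ []
    g≢g′ : g ≢ g′
    g≢g′ refl = IsSimple.irrefl simple₁ e
    h≢h′ : h ≢ h′
    h≢h′ refl = IsSimple.irrefl simple₂ e′
    rows-differ : ∀ {a a′ : Fin m} {b b′ : Fin n} → a ≢ a′ → combine a b ≢ combine a′ b′
    rows-differ {a} {a′} {b} {b′} a≢a′ eq = a≢a′ (proj₁ (combine-injective a b a′ b′ eq))
    cols-differ : ∀ {a a′ : Fin m} {b b′ : Fin n} → b ≢ b′ → combine a b ≢ combine a′ b′
    cols-differ {a} {a′} {b} {b′} b≢b′ eq = b≢b′ (proj₂ (combine-injective a b a′ b′ eq))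
    distinct : Unique corners
    distinct = (rows-differ g≢g′ ∷ rows-differ g≢g′ ∷ cols-differ h≢h′ ∷ [])
             ∷ (cols-differ h≢h′ ∷ rows-differ (g≢g′ ∘ sym) ∷ [])
             ∷ (rows-differ (g≢g′ ∘ sym) ∷ [])
             ∷ [] ∷ []

  square-closed : ∀ {C g g′ h h′} → Convex (G □ H) C → G g g′ → H h h′ →
                  combine g′ h ∈ C → combine g′ h′ ∈ C → combine g h′ ∈ C → combine g h ∈ C
  square-closed {C} {g} {h = h} convex e e′ c₁ c₂ c₃ = convex _ (inj₂ (square e e′ , on-square , zero , refl))
    where
    on-square : ∀ i → vtx (square e e′) i ∈ C ⊎ vtx (square e e′) i ≡ combine g h
    on-square zero                   = inj₂ refl
    on-square (suc zero)             = inj₁ c₁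
    on-square (suc (suc zero))       = inj₁ c₂
    on-square (suc (suc (suc zero))) = inj₁ c₃

module _ {m n} {G : Graph (suc m)} {H : Graph (suc n)} (simple₁ : IsSimple G) (simple₂ : IsSimple H) where

  open Coordinates (suc m) (suc n)

  axes-isHullSet : Connected G → Connected H → IsHullSet (G □ H) (axes m n)
  axes-isHullSet connected₁ connected₂ w C convex axes⊆C =
    subst (_∈ C) (combine-remQuot {suc m} (suc n) w) (row-in (row w) (connected₁ (row w) zero) (col w))
    where
    row-in : ∀ g → Star G g zero → ∀ h → combine g h ∈ C
    row-next-to : ∀ {g g′} → G g g′ → (∀ h → combine g′ h ∈ C) → ∀ h → Star H h zero → combine g h ∈ C
    row-in g ε          h = axes⊆C (firstRow∈axes {m} h)
    row-in g (e ◅ walk) h = row-next-to e (row-in _ walk) h (connected₂ h zero)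
    row-next-to {g} e row′-in h ε = axes⊆C (firstColumn∈axes g)
    row-next-to e row′-in h (e′ ◅ walk) =
      square-closed simple₁ simple₂ convex e e′ (row′-in h) (row′-in _) (row-next-to e row′-in _ walk)

mainTheorem7 : ∀ (m n : ℕ) (T₁ : Graph m) (T₂ : Graph n) →
    2 ≤ m → 2 ≤ n → IsTree T₁ → IsTree T₂ →
    (Σ (Subset (m * n)) λ S → IsHullSet (T₁ □ T₂) S × ∣ S ∣ ≡ m + n ∸ 1)
    × (∀ (S : Subset (m * n)) → IsHullSet (T₁ □ T₂) S → m + n ∸ 1 ≤ ∣ S ∣)
mainTheorem7 (suc m) (suc n) T₁ T₂ _ _ (simple₁ , connected₁ , acyclic₁) (simple₂ , connected₂ , acyclic₂) =
  (axes m n , axes-isHullSet simple₁ simple₂ connected₁ connected₂ , ∣axes∣ m n) ,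
  λ S → hullSet-size acyclic₁ acyclic₂
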